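{- Let $t \ge 3$ be an integer and let $g$ be the Sprague-Grundy function of \textsc{Mark}-$t$ in normal play. Suppose $n$ and $m$ are nonnegative integers with base-$t$ representations $R(n) = w\,k\,(t-1)^r$ and $R(m) = w\,k\,(t-1)$, where $k$ is a digit with $k \ne t-1$, $r > 1$ is an integer, and $w$ is a (possibly empty) string of base-$t$ digits. Then $g(n) = g(m)$ if and only if $r$ is odd.
   Context: \textsc{Mark}-$t$ is the impartial game whose positions are the nonnegative integers; from a position $n \ge 1$ a move goes to any nonnegative one of $n-1, \ldots, n-(t-1)$, or to $\lfloor n/t \rfloor$; $0$ has no moves. In normal play the player unable to move loses. The Sprague-Grundy function is $g(n) = \operatorname{mex}\{g(m) : m \text{ an option of } n\}$, with $\operatorname{mex} S$ the least nonnegative integer not in $S$. $R(n)$ is the base-$t$ representation of $n$ (no leading zeros), and $(t-1)^r$ denotes $r$ consecutive digits $t-1$; juxtaposition denotes concatenation of digit strings. -}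

module Defs where

open import Data.Nat using (ℕ; zero; suc; _+_; _*_; _∸_; _≤_; _<_; NonZero)
open import Data.Nat.DivMod using (_/_)
open import Data.List using (List; []; _∷_; foldl)
open import Data.List.Relation.Unary.All using (All)
open import Data.Product using (Σ; _×_; ∃)
open import Data.Unit using (⊤)
open import Relation.Binary.PropositionalEquality using (_≡_; _≢_)
open import Relation.Nullary using (¬_)

data Option (t : ℕ) .{{_ : NonZero t}} : ℕ → ℕ → Set where
  sub : ∀ {n} i → 1 ≤ i → i ≤ t ∸ 1 → i ≤ n → 1 ≤ n → Option t n (n ∸ i)
  div : ∀ {n} → 1 ≤ n → Option t n (n / t)

IsMexOfOptions : (t : ℕ) .{{_ : NonZero t}} → (ℕ → ℕ) → ℕ → ℕ → Set
IsMexOfOptions t g n x =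
  (¬ (Σ ℕ λ m → Option t n m × g m ≡ x)) ×
  (∀ y → y < x → Σ ℕ λ m → Option t n m × g m ≡ y)

IsSGFunction : (t : ℕ) .{{_ : NonZero t}} → (ℕ → ℕ) → Set
IsSGFunction t g = ∀ n → IsMexOfOptions t g n (g n)

-- value of a digit string (most significant digit first) in base t
evalBase : ℕ → List ℕ → ℕ
evalBase t = foldl (λ acc d → acc * t + d) 0

IsBaseRep : ℕ → ℕ → List ℕ → Set
IsBaseRep t n ds = All (λ d → d < t) ds × NoLeadingZero ds × evalBase t ds ≡ n
  where
  NoLeadingZero : List ℕ → Set
  NoLeadingZero [] = ⊤  -- (not reached here: strings in the statement are nonempty)
  NoLeadingZero (d ∷ _) = d ≢ 0

-- Write q ⊲ j = q t + j, the number whose base-t representation is R(q) j.  By strong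
-- induction, for every digit j < t − 1 the value g(q ⊲ j) is j unless g(q) = j, and then
-- g(q ⊲ j) ≥ t − 1: the subtraction moves from q ⊲ j lead to numbers with another last
-- digit, and the division move leads to q.  Hence the moves from a ⊲ (t − 1) attain every
-- value below t − 1, and since a position has at most t moves, g(a ⊲ (t − 1)) ∈ {t − 1, t}.
-- The division move from a ⊲ (t − 1) to a forces g(a ⊲ (t − 1)) ≠ g(a), so appending the
-- digit t − 1 repeatedly makes g alternate between t − 1 and t.
module Submission where

open import Defs
open import Data.Nat
  using (ℕ; zero; suc; _+_; _*_; _∸_; _/_; _%_; _≤_; _<_; _≮_; s≤s; z<s; _<?_;
         NonZero; >-nonZero⁻¹)
open import Data.Nat.Properties
open import Data.Nat.DivMod
open import Data.Nat.GeneralisedArithmetic using (iterate)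
open import Data.Nat.Induction using (<-rec)
open import Data.Fin using (Fin; zero; toℕ; fromℕ<)
open import Data.Fin.Properties using (pigeonhole; fromℕ<-injective; toℕ<n)
open import Data.List using (List; []; _∷_; _++_; replicate; foldl)
open import Data.List.Properties using (foldl-++; ++-assoc)
open import Data.Product using (Σ; _×_; _,_; proj₁; proj₂)
open import Data.Sum using (_⊎_; inj₁; inj₂)
open import Data.Empty using (⊥; ⊥-elim)
open import Relation.Nullary using (yes; no; contradiction)
open import Relation.Binary.PropositionalEquality
  using (_≡_; _≢_; refl; sym; trans; ≢-sym; cong; cong₂; subst; subst₂; module ≡-Reasoning)
open import Function.Bundles using (_⇔_; mk⇔)

m+n∸[n∸o]≡m+o : ∀ m {n o} → o ≤ n → m + n ∸ (n ∸ o) ≡ m + o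
m+n∸[n∸o]≡m+o m {n} {o} o≤n = begin
  m + n ∸ (n ∸ o)   ≡⟨ +-∸-assoc m (m∸n≤m n o) ⟩
  m + (n ∸ (n ∸ o)) ≡⟨ cong (m +_) (m∸[m∸n]≡n o≤n) ⟩
  m + o             ∎
  where open ≡-Reasoning

foldl-replicate : ∀ {A B : Set} (f : A → B → A) x n y →
                  foldl f x (replicate n y) ≡ iterate (λ z → f z y) x n
foldl-replicate f x zero    y = refl
foldl-replicate f x (suc n) y = foldl-replicate f (f x y) n y

evalBase-++-replicate : ∀ t ds r d →
  evalBase t (ds ++ replicate r d) ≡ iterate (λ a → a * t + d) (evalBase t ds) r
evalBase-++-replicate t ds r d = begin
  evalBase t (ds ++ replicate r d)                ≡⟨ foldl-++ step 0 ds (replicate r d) ⟩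
  foldl step (evalBase t ds) (replicate r d)      ≡⟨ foldl-replicate step (evalBase t ds) r d ⟩
  iterate (λ a → a * t + d) (evalBase t ds) r     ∎
  where
  open ≡-Reasoning
  step : ℕ → ℕ → ℕ
  step acc d = acc * t + d

two-valued-alternating⇒≡ : ∀ {A : Set} {u v x y z : A} →
  x ≡ u ⊎ x ≡ v → y ≡ u ⊎ y ≡ v → z ≡ u ⊎ z ≡ v → y ≢ x → z ≢ y → z ≡ x
two-valued-alternating⇒≡ (inj₁ x≡u) (inj₁ y≡u) _ y≢x _ = contradiction (trans y≡u (sym x≡u)) y≢x
two-valued-alternating⇒≡ (inj₂ x≡v) (inj₂ y≡v) _ y≢x _ = contradiction (trans y≡v (sym x≡v)) y≢x
two-valued-alternating⇒≡ _ (inj₁ y≡u) (inj₁ z≡u) _ z≢y = contradiction (trans z≡u (sym y≡u)) z≢y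
two-valued-alternating⇒≡ _ (inj₂ y≡v) (inj₂ z≡v) _ z≢y = contradiction (trans z≡v (sym y≡v)) z≢y
two-valued-alternating⇒≡ (inj₁ x≡u) (inj₂ _) (inj₁ z≡u) _ _ = trans z≡u (sym x≡u)
two-valued-alternating⇒≡ (inj₂ x≡v) (inj₁ _) (inj₂ z≡v) _ _ = trans z≡v (sym x≡v)

module Mark (c : ℕ) .{{_ : NonZero c}} (g : ℕ → ℕ) (g-sg : IsSGFunction (suc c) g) where

  t : ℕ
  t = suc c

  infixl 6 _⊲_
  _⊲_ : ℕ → ℕ → ℕ
  q ⊲ j = q * t + j

  option-≢ : ∀ {n m} → Option t n m → g m ≢ g n
  option-≢ {n} {m} o gm≡gn = proj₁ (g-sg n) (m , o , gm≡gn)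

  attained : ∀ {n y} → y < g n → Σ ℕ λ m → Option t n m × g m ≡ y
  attained {n} {y} = proj₂ (g-sg n) y

  no-option-from-0 : ∀ {m} → Option t 0 m → ⊥
  no-option-from-0 (sub _ _ _ _ ())
  no-option-from-0 (div ())

  g-0 : g 0 ≡ 0
  g-0 = n≤0⇒n≡0 (≮⇒≥ λ 0<g0 → no-option-from-0 (proj₁ (proj₂ (attained 0<g0))))

  1<t : 1 < t
  1<t = s≤s (>-nonZero⁻¹ c)

  ⊲-/ : ∀ q {j} → j < t → (q ⊲ j) / t ≡ q
  ⊲-/ q {j} j<t = begin
    (q * t + j) / t   ≡⟨ +-distrib-/ (q * t) j no-carry ⟩
    q * t / t + j / t ≡⟨ cong₂ _+_ (m*n/n≡m q t) (m<n⇒m/n≡0 j<t) ⟩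
    q + 0             ≡⟨ +-identityʳ q ⟩
    q                 ∎
    where
    open ≡-Reasoning
    no-carry : (q * t) % t + j % t < t
    no-carry = subst₂ (λ a b → a + b < t) (sym (m*n%n≡0 q t)) (sym (m<n⇒m%n≡m j<t)) j<t

  ⊲-monoʳ-< : ∀ q {y j} → y < j → q ⊲ y < q ⊲ j
  ⊲-monoʳ-< q = +-monoʳ-< (q * t)

  ⊲-<-suc : ∀ q {x} j → x < t → q ⊲ x < suc q ⊲ j
  ⊲-<-suc q {x} j x<t = begin-strict
    q * t + x <⟨ +-monoʳ-< (q * t) x<t ⟩
    q * t + t ≡⟨ +-comm (q * t) t ⟩
    suc q * t ≤⟨ m≤m+n (suc q * t) j ⟩
    suc q ⊲ j ∎
    where open ≤-Reasoning

  suc-<-⊲ : ∀ q j → suc q < suc q ⊲ j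
  suc-<-⊲ q j = <-≤-trans (m<m*n (suc q) t 1<t) (m≤m+n (suc q * t) j)

  data DigitSplit : ℕ → Set where
    digit-split : ∀ a b → b < t → DigitSplit (a ⊲ b)

  split : ∀ m → DigitSplit m
  split m = subst DigitSplit ⊲-/-% (digit-split (m / t) (m % t) (m%n<n m t))
    where
    ⊲-/-% : m / t ⊲ m % t ≡ m
    ⊲-/-% = trans (+-comm (m / t * t) (m % t)) (sym (m≡m%n+[m/n]*n m t))

  a⊲j+i≡q⊲j⇒i≡0 : ∀ a q {j i} → a ⊲ j + i ≡ q ⊲ j → i < t → i ≡ 0
  a⊲j+i≡q⊲j⇒i≡0 a q {j} {i} eq i<t = begin
    i               ≡⟨ m<n⇒m%n≡m i<t ⟨
    i % t           ≡⟨ [m+kn]%n≡m%n i a t ⟨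
    (i + a * t) % t ≡⟨ cong (_% t) i+a*t≡q*t ⟩
    (q * t) % t     ≡⟨ m*n%n≡0 q t ⟩
    0               ∎
    where
    open ≡-Reasoning
    i+a*t≡q*t : i + a * t ≡ q * t
    i+a*t≡q*t = +-cancelʳ-≡ j (i + a * t) (q * t) (begin
      i + a * t + j   ≡⟨ cong (_+ j) (+-comm i (a * t)) ⟩
      a * t + i + j   ≡⟨ +-assoc (a * t) i j ⟩
      a * t + (i + j) ≡⟨ cong (a * t +_) (+-comm i j) ⟩
      a * t + (j + i) ≡⟨ +-assoc (a * t) j i ⟨
      a ⊲ j + i       ≡⟨ eq ⟩
      q ⊲ j           ∎)

  div-option : ∀ q {j} → j < t → 1 ≤ q ⊲ j → Option t (q ⊲ j) q
  div-option q j<t 1≤n = subst (Option t _) (⊲-/ q j<t) (div 1≤n)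

  lower-option : ∀ x {y z} → y < z → z ∸ y ≤ c → Option t (x + z) (x + y)
  lower-option x {y} {z} y<z z∸y≤c =
    subst (Option t (x + z)) (m+n∸[n∸o]≡m+o x (<⇒≤ y<z))
      (sub (z ∸ y) (m<n⇒0<n∸m y<z) z∸y≤c (≤-trans (m∸n≤m z y) (m≤n+m z x)) 1≤x+z)
    where
    1≤x+z : 1 ≤ x + z
    1≤x+z = ≤-trans (<-≤-trans z<s y<z) (m≤n+m z x)

  LowDigitLaw : ℕ → ℕ → Set
  LowDigitLaw q j = g (q ⊲ j) ≡ j ⊎ (g q ≡ j × c ≤ g (q ⊲ j))

  low-digit-option : ∀ q {y j} → y < j → j < t → LowDigitLaw q y →
                     Σ ℕ λ m → Option t (q ⊲ j) m × g m ≡ y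
  low-digit-option q {y} {j} y<j j<t (inj₁ g≡y) =
    q ⊲ y , lower-option (q * t) y<j (≤-trans (m∸n≤m j y) (≤-pred j<t)) , g≡y
  low-digit-option q {j = j} y<j j<t (inj₂ (gq≡y , _)) =
    q , div-option q j<t (≤-trans (<-≤-trans z<s y<j) (m≤n+m j (q * t))) , gq≡y

  digit-≤-g : ∀ q {j} → j < t → (∀ {y} → y < j → LowDigitLaw q y) → j ≤ g (q ⊲ j)
  digit-≤-g q j<t laws = ≮⇒≥ λ g<j →
    let (_ , o , gm≡g) = low-digit-option q g<j j<t (laws g<j) in option-≢ o gm≡g

  LawsBelow : ℕ → Set
  LawsBelow n = ∀ {q j} → q ⊲ j < n → j < c → LowDigitLaw q j

  small-g-is-digit : ∀ {n a b} → LawsBelow n → a ⊲ b < n → b < t → g (a ⊲ b) < c →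
                     g (a ⊲ b) ≡ b
  small-g-is-digit {a = a} {b} laws ab<n b<t g<c with b <? c
  ... | yes b<c with laws {a} {b} ab<n b<c
  ...   | inj₁ g≡b       = g≡b
  ...   | inj₂ (_ , c≤g) = contradiction c≤g (<⇒≱ g<c)
  small-g-is-digit {a = a} {b} laws ab<n b<t g<c | no b≮c =
    contradiction (≤-trans (≮⇒≥ b≮c) (digit-≤-g a b<t laws-a)) (<⇒≱ g<c)
    where
    laws-a : ∀ {y} → y < b → LowDigitLaw a y
    laws-a {y} y<b = laws {a} {y} (<-trans (⊲-monoʳ-< a y<b) ab<n) (<-≤-trans y<b (≤-pred b<t))

  subtraction-misses-digit : ∀ {q j m i} → LawsBelow (q ⊲ j) → j < c → 1 ≤ i → i < t →
                             m + i ≡ q ⊲ j → g m ≢ j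
  subtraction-misses-digit {q} {j} {m} {i} laws j<c 1≤i i<t m+i≡n gm≡j with split m
  ... | digit-split a b b<t = contradiction (a⊲j+i≡q⊲j⇒i≡0 a q a⊲j+i≡q⊲j i<t) (>⇒≢ 1≤i)
    where
    m<n : a ⊲ b < q ⊲ j
    m<n = subst (a ⊲ b <_) m+i≡n (m<m+n (a ⊲ b) 1≤i)
    g<c : g (a ⊲ b) < c
    g<c = subst (_< c) (sym gm≡j) j<c
    b≡j : b ≡ j
    b≡j = trans (sym (small-g-is-digit {q ⊲ j} {a} {b} laws m<n b<t g<c)) gm≡j
    a⊲j+i≡q⊲j : a ⊲ j + i ≡ q ⊲ j
    a⊲j+i≡q⊲j = subst (λ d → a ⊲ d + i ≡ q ⊲ j) b≡j m+i≡n

  small-g-suc : ∀ {n} q → LawsBelow n → suc q < n → g q < c → g (suc q) < c →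
                g (suc q) ≡ suc (g q)
  small-g-suc {n} q laws sq<n gq<c gsq<c with split q
  ... | digit-split a b b<t = begin
    g (suc (a ⊲ b)) ≡⟨ cong g a⊲sb≡s[a⊲b] ⟨
    g (a ⊲ suc b)   ≡⟨ small-g-is-digit {n} {a} {suc b} laws
                         (subst (_< n) (sym a⊲sb≡s[a⊲b]) sq<n) sb<t
                         (subst (_< c) (cong g (sym a⊲sb≡s[a⊲b])) gsq<c) ⟩
    suc b           ≡⟨ cong suc gab≡b ⟨
    suc (g (a ⊲ b)) ∎
    where
    open ≡-Reasoning
    a⊲sb≡s[a⊲b] : a ⊲ suc b ≡ suc (a ⊲ b)
    a⊲sb≡s[a⊲b] = +-suc (a * t) b
    gab≡b : g (a ⊲ b) ≡ b
    gab≡b = small-g-is-digit {n} {a} {b} laws (<-trans (n<1+n (a ⊲ b)) sq<n) b<t gq<c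
    sb<t : suc b < t
    sb<t = s≤s (subst (_< c) gab≡b gq<c)

  -- Were j < x < c for x = g((q + 1) ⊲ j), the move to q ⊲ x would force g(q) = x, hence
  -- g(q + 1) = x + 1, contradicting g(q + 1) = j < x.
  blocked-digit-≥-c : ∀ q {j} → LawsBelow (q ⊲ j) → j < c → g q ≡ j → j < g (q ⊲ j) →
                      c ≤ g (q ⊲ j)
  blocked-digit-≥-c zero {j} _ _ g0≡j j<g =
    ⊥-elim (n≮0 (subst (0 <_) g-0 (subst (λ k → k < g k) (trans (sym g0≡j) g-0) j<g)))
  blocked-digit-≥-c (suc q) {j} laws j<c gsq≡j j<x = ≮⇒≥ x≮c
    where
    x : ℕ
    x = g (suc q ⊲ j)
    x≮c : x ≮ c
    x≮c x<c with laws {q} {x} (⊲-<-suc q j (m<n⇒m<1+n x<c)) x<c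
    ... | inj₁ gqx≡x    = option-≢ drop gqx≡x
      where
      t+j≤x+c : t + j ≤ x + c
      t+j≤x+c = ≤-trans (≤-reflexive (cong suc (+-comm c j))) (+-monoˡ-≤ c j<x)
      drop : Option t (suc q ⊲ j) (q ⊲ x)
      drop = subst (λ n → Option t n (q ⊲ x))
               (trans (sym (+-assoc (q * t) t j)) (cong (_+ j) (+-comm (q * t) t)))
               (lower-option (q * t) (<-≤-trans (m<n⇒m<1+n x<c) (m≤m+n t j))
                 (m≤n+o⇒m∸n≤o (t + j) x t+j≤x+c))
    ... | inj₂ (gq≡x , _) = <-asym j<x (subst (x <_) (sym j≡sx) (n<1+n x))
      where
      j≡sx : j ≡ suc x
      j≡sx = begin
        j           ≡⟨ gsq≡j ⟨
        g (suc q)   ≡⟨ small-g-suc q laws (suc-<-⊲ q j) (subst (_< c) (sym gq≡x) x<c)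
                                          (subst (_< c) (sym gsq≡j) j<c) ⟩
        suc (g q)   ≡⟨ cong suc gq≡x ⟩
        suc x       ∎
        where open ≡-Reasoning

  low-digit-law-step : ∀ q {j} → LawsBelow (q ⊲ j) → j < c → LowDigitLaw q j
  low-digit-law-step q {j} laws j<c
    with m≤n⇒m<n∨m≡n (digit-≤-g q (m<n⇒m<1+n j<c)
                        λ {y} y<j → laws {q} {y} (⊲-monoʳ-< q y<j) (<-trans y<j j<c))
  ... | inj₂ j≡g = inj₁ (sym j≡g)
  ... | inj₁ j<g with attained j<g
  ...   | _ , sub i 1≤i i≤c i≤n _ , g≡j =
    contradiction g≡j (subtraction-misses-digit {q} {j} laws j<c 1≤i (s≤s i≤c) (m∸n+n≡m i≤n))
  ...   | _ , div _ , g≡j = inj₂ (gq≡j , blocked-digit-≥-c q laws j<c gq≡j j<g)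
    where
    gq≡j : g q ≡ j
    gq≡j = trans (cong g (sym (⊲-/ q (m<n⇒m<1+n j<c)))) g≡j

  laws-below : ∀ n → LawsBelow n
  laws-below = <-rec LawsBelow λ _ rec {q} {j} qj<n j<c →
    low-digit-law-step q (rec qj<n) j<c

  c≤g-⊲c : ∀ a → c ≤ g (a ⊲ c)
  c≤g-⊲c a = digit-≤-g a (n<1+n c) λ {y} → laws-below (suc (a ⊲ y)) {a} {y} (n<1+n (a ⊲ y))

  option-index : ∀ {n m} → Option t n m → Fin t
  option-index (sub i _ i≤c _ _) = fromℕ< (s≤s i≤c)
  option-index (div _)           = zero

  option-index-injective : ∀ {n m m′} (o : Option t n m) (o′ : Option t n m′) →
                           option-index o ≡ option-index o′ → m ≡ m′
  option-index-injective {n} (sub i _ i≤c _ _) (sub i′ _ i′≤c _ _) same =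
    cong (n ∸_) (fromℕ<-injective i i′ (s≤s i≤c) (s≤s i′≤c) same)
  option-index-injective (sub _ (s≤s _) _ _ _) (div _) ()
  option-index-injective (div _) (sub _ (s≤s _) _ _ _) ()
  option-index-injective (div _) (div _) _ = refl

  g≤t : ∀ n → g n ≤ t
  g≤t n = ≮⇒≥ λ t<g →
    let (i , j , i<j , same-index) = pigeonhole (n<1+n t) (index t<g)
    in <-irrefl (same-value t<g i j same-index) i<j
    where
    option-for : t < g n → (k : Fin (suc t)) → Σ ℕ λ m → Option t n m × g m ≡ toℕ k
    option-for t<g k = attained (<-≤-trans (toℕ<n k) t<g)
    index : t < g n → Fin (suc t) → Fin t
    index t<g k = option-index (proj₁ (proj₂ (option-for t<g k)))
    same-value : (t<g : t < g n) → ∀ i j → index t<g i ≡ index t<g j → toℕ i ≡ toℕ j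
    same-value t<g i j same =
      let (_ , oᵢ , gᵢ≡i) = option-for t<g i
          (_ , oⱼ , gⱼ≡j) = option-for t<g j
      in trans (sym gᵢ≡i) (trans (cong g (option-index-injective oᵢ oⱼ same)) gⱼ≡j)

  appendTop : ℕ → ℕ
  appendTop a = a ⊲ c

  g-appendTop-∈ : ∀ a → g (appendTop a) ≡ c ⊎ g (appendTop a) ≡ t
  g-appendTop-∈ a with m≤n⇒m<n∨m≡n (g≤t (appendTop a))
  ... | inj₁ g<t = inj₁ (≤-antisym (≤-pred g<t) (c≤g-⊲c a))
  ... | inj₂ g≡t = inj₂ g≡t

  g-appendTop-≢ : ∀ a → g (appendTop a) ≢ g a
  g-appendTop-≢ a =
    ≢-sym (option-≢ (div-option a (n<1+n c) (≤-trans (>-nonZero⁻¹ c) (m≤n+m c (a * t)))))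

  g-appendTop³ : ∀ a → g (appendTop (appendTop (appendTop a))) ≡ g (appendTop a)
  g-appendTop³ a = two-valued-alternating⇒≡
    (g-appendTop-∈ a) (g-appendTop-∈ (appendTop a)) (g-appendTop-∈ (appendTop (appendTop a)))
    (g-appendTop-≢ (appendTop a)) (g-appendTop-≢ (appendTop (appendTop a)))

  g-iterate-appendTop-parity : ∀ a r →
    (g (iterate appendTop a (suc r)) ≡ g (appendTop a)) ⇔ (suc r % 2 ≡ 1)
  g-iterate-appendTop-parity a zero          = mk⇔ (λ _ → refl) (λ _ → refl)
  g-iterate-appendTop-parity a (suc zero)    =
    mk⇔ (λ same → contradiction same (g-appendTop-≢ (appendTop a))) λ ()
  g-iterate-appendTop-parity a (suc (suc r)) =
    subst (λ v → (g (iterate appendTop a″ (suc r)) ≡ v) ⇔ (suc r % 2 ≡ 1))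
      (g-appendTop³ a) (g-iterate-appendTop-parity a″ r)
    where
    a″ : ℕ
    a″ = appendTop (appendTop a)

lemma2 : (t : ℕ) → .{{_ : NonZero t}} → 3 ≤ t → (g : ℕ → ℕ) → IsSGFunction t g →
    (n m : ℕ) → (w : List ℕ) → (k : ℕ) → (r : ℕ) →
    k < t → k ≢ t ∸ 1 → 1 < r →
    IsBaseRep t n (w ++ k ∷ replicate r (t ∸ 1)) →
    IsBaseRep t m (w ++ k ∷ (t ∸ 1) ∷ []) →
    (g n ≡ g m) ⇔ (r % 2 ≡ 1)
lemma2 (suc c) (s≤s (s≤s (s≤s _))) g g-sg n m w k (suc r) _ _ (s≤s (s≤s _))
       (_ , _ , n-value) (_ , _ , m-value) =
  subst₂ (λ a b → (g a ≡ g b) ⇔ (suc r % 2 ≡ 1))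
    (trans (chain (suc r)) n-value) (trans (chain 1) m-value)
    (g-iterate-appendTop-parity prefix r)
  where
  open Mark c g g-sg
  prefix : ℕ
  prefix = evalBase t (w ++ k ∷ [])
  chain : ∀ r → iterate appendTop prefix r ≡ evalBase t (w ++ k ∷ replicate r c)
  chain r = trans (sym (evalBase-++-replicate t (w ++ k ∷ []) r c))
                  (cong (evalBase t) (++-assoc w (k ∷ []) (replicate r c)))
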